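{- Let $k>1$ be a rational integer such that $k \equiv 11 \pmod{12}$ and such that $(1-\omega)^k - 1$ is an Eisenstein Mersenne prime. Then $\alpha = (1-\omega)^{k-1}\left[(1-\omega)^k - 1\right]$ is an even norm-perfect Eisenstein integer.
   Context: Let $\omega = e^{2\pi i/3} = \frac{ -1+\sqrt{ -3}}{2}$, so $1+\omega+\omega^2=0$, and let $\mathbb{Z}[\omega]=\{a+b\omega : a,b\in\mathbb{Z}\}$ be the ring of Eisenstein integers (a unique factorization domain with units $\pm1,\pm\omega,\pm\omega^2$). The norm is $N(a+b\omega)=a^2-ab+b^2$. An Eisenstein integer is called even if it is divisible by $1-\omega$ in $\mathbb{Z}[\omega]$, and odd otherwise. An Eisenstein Mersenne prime is a prime element of $\mathbb{Z}[\omega]$ of the form $(1-\omega)^p-1$ with $p$ a rational prime. Every nonzero $\nu\in\mathbb{Z}[\omega]$ is written as $\nu=\epsilon\prod_{q=1}^{s}\pi_q^{k_q}$, where $\epsilon$ is a unit, the $\pi_q$ are pairwise distinct primes each of the form $a+b\omega$ with $a>b\ge 0$ (the chosen associate), and the $k_q$ are positive integers. The complex sum of divisors function is $\sigma^\star(\nu)=\prod_{q=1}^{s}\frac{\pi_q^{k_q+1}-1}{\pi_q-1}$. An Eisenstein integer $\alpha$ is norm-perfect if $N[\sigma^\star(\alpha)] = 3\cdot N[\alpha]$. -}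

module Defs where

open import Data.Nat as ℕ using (ℕ; zero; suc)
open import Data.Integer as ℤ using (ℤ; +_; -_)
open import Data.Product using (Σ; ∃; _×_; _,_)
open import Data.Sum using (_⊎_)
open import Data.List using (List; []; _∷_; map; foldr)
open import Data.List.Relation.Unary.All using (All)
open import Data.List.Relation.Unary.Unique.Propositional using (Unique)
open import Relation.Binary.PropositionalEquality using (_≡_)
open import Relation.Nullary using (¬_)

-- Eisenstein integer a + b ω, with ω² = -1 - ω
record 𝔼 : Set where
  constructor _+_ω
  field
    re : ℤ
    im : ℤ
open 𝔼 public

infixl 6 _⊕_ _⊖_
infixl 7 _⊗_

0𝔼 1𝔼 ω𝔼 : 𝔼
0𝔼 = (+ 0) + (+ 0) ω
1𝔼 = (+ 1) + (+ 0) ω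
ω𝔼 = (+ 0) + (+ 1) ω

_⊕_ : 𝔼 → 𝔼 → 𝔼
(a + b ω) ⊕ (c + d ω) = (a ℤ.+ c) + (b ℤ.+ d) ω

⊝_ : 𝔼 → 𝔼
⊝ (a + b ω) = (ℤ.- a) + (ℤ.- b) ω

_⊖_ : 𝔼 → 𝔼 → 𝔼
x ⊖ y = x ⊕ (⊝ y)

_⊗_ : 𝔼 → 𝔼 → 𝔼
(a + b ω) ⊗ (c + d ω) =
  (a ℤ.* c ℤ.- b ℤ.* d) + (a ℤ.* d ℤ.+ b ℤ.* c ℤ.- b ℤ.* d) ω

_^𝔼_ : 𝔼 → ℕ → 𝔼
x ^𝔼 zero = 1𝔼
x ^𝔼 suc n = x ⊗ (x ^𝔼 n)

N : 𝔼 → ℤ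
N (a + b ω) = a ℤ.* a ℤ.- a ℤ.* b ℤ.+ b ℤ.* b

_∣𝔼_ : 𝔼 → 𝔼 → Set
x ∣𝔼 y = ∃ λ q → y ≡ q ⊗ x

IsUnit : 𝔼 → Set
IsUnit u = ∃ λ v → u ⊗ v ≡ 1𝔼

IsPrime𝔼 : 𝔼 → Set
IsPrime𝔼 p = ¬ (p ≡ 0𝔼) × ¬ IsUnit p ×
  (∀ x y → p ∣𝔼 (x ⊗ y) → (p ∣𝔼 x) ⊎ (p ∣𝔼 y))

λ𝔼 : 𝔼
λ𝔼 = 1𝔼 ⊖ ω𝔼

Even : 𝔼 → Set
Even x = λ𝔼 ∣𝔼 x

open import Data.Nat.Primality using (Prime)
IsEisensteinMersennePrime : 𝔼 → Set
IsEisensteinMersennePrime m =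
  ∃ λ p → Prime p × m ≡ (λ𝔼 ^𝔼 p) ⊖ 1𝔼 × IsPrime𝔼 m

-- the chosen associate: a + bω with a > b ≥ 0
Normalized : 𝔼 → Set
Normalized (a + b ω) = (b ℤ.< a) × (+ 0 ℤ.≤ b)

-- a factorization ν = ε ∏ π_q^{k_q}: list of pairs (π_q , k_q)
Factorization : Set
Factorization = List (Σ 𝔼 λ _ → ℕ)

prod𝔼 : List 𝔼 → 𝔼
prod𝔼 = foldr _⊗_ 1𝔼

primePart : Factorization → 𝔼
primePart f = prod𝔼 (map (λ { (π , k) → π ^𝔼 k }) f)

IsFactorizationOf : Factorization → 𝔼 → Set
IsFactorizationOf f ν =
  All (λ { (π , k) → IsPrime𝔼 π × Normalized π × 1 ℕ.≤ k }) f ×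
  Unique (map (λ { (π , _) → π }) f) ×
  (∃ λ ε → IsUnit ε × ν ≡ ε ⊗ primePart f)

-- 1 + π + ... + π^k  ( = (π^{k+1} - 1)/(π - 1) , exact division )
geomSum : 𝔼 → ℕ → 𝔼
geomSum π zero = 1𝔼
geomSum π (suc k) = geomSum π k ⊕ (π ^𝔼 suc k)

σ⋆ : Factorization → 𝔼
σ⋆ f = prod𝔼 (map (λ { (π , k) → geomSum π k }) f)

-- norm-perfect: N[σ⋆(α)] = 3 N[α], where σ⋆(α) is computed from the
-- factorization of α (which exists and is unique up to order)
NormPerfect : 𝔼 → Set
NormPerfect α =
  (∃ λ f → IsFactorizationOf f α) ×
  (∀ f → IsFactorizationOf f α → N (σ⋆ f) ≡ (+ 3) ℤ.* N α)

-- Write k = e + 1 with e = 10 + 12q. Since λ² = -3ω we have λ¹² = 729, hence λᵉ = t (1 + ω) and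
-- π₃ᵉ = -t ω for t = 243 · 729^q, where π₃ = 2 + ω = (1 + ω) λ is the normalized prime above 3.
-- Thus α = λᵉ M = ω π₃ᵉ M with M = λᵏ - 1 = (2t - 1) + t ω, a normalized prime different from π₃.
-- The normalized primes in any factorization of α divide ω π₃ᵉ M, so they are π₃ and M, and
-- cancelling one prime at a time fixes their exponents: σ⋆(α) = (1 + π₃ + ⋯ + π₃ᵉ)(1 + M) for every
-- factorization. As N(π₃ - 1) = 1, the first factor has norm N(π₃ᵏ - 1) = 3t² - 3t + 1 = N(M), and
-- the second has norm 3t² = 3 N(λᵉ); hence N(σ⋆(α)) = 3 N(α).

module Submission where

open import Defs
open import Data.Empty using (⊥; ⊥-elim)
open import Data.Integer as ℤ using (ℤ; +_; -_; -[1+_]; _*_; _-_; ∣_∣; +≤+; +<+) renaming (_+_ to _+ℤ_)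
import Data.Integer.Divisibility.Signed as ℤ
open import Data.Integer.Divisibility.Signed using (divides)
import Data.Integer.Properties as ℤ
open import Data.Integer.Tactic.RingSolver using (solve-∀)
open import Data.List using ([]; _∷_; map)
open import Data.List.Relation.Unary.All as All using (All; []; _∷_)
open import Data.List.Relation.Unary.AllPairs using ([]; _∷_)
open import Data.List.Relation.Unary.Unique.Propositional using (Unique)
open import Data.Nat as ℕ using (ℕ; zero; suc; z≤n; s≤s; _<_; _%_; _∸_)
import Data.Nat.Divisibility as ℕ
open import Data.Nat.DivMod using (_/_; m≡m%n+[m/n]*n)
open import Data.Nat.Primality using (prime?; euclidsLemma)
import Data.Nat.Properties as ℕ
open import Data.Product using (Σ; ∃; _×_; _,_; proj₁; proj₂; map₁)
open import Data.Sum as Sum using (_⊎_; inj₁; inj₂; [_,_]′)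
open import Relation.Binary.PropositionalEquality
open import Relation.Nullary using (¬_)
open import Relation.Nullary.Decidable using (toWitness)
open import Algebra.Bundles using (CommutativeSemigroup)
open import Algebra.Structures {A = 𝔼} _≡_ using (IsCommutativeSemigroup)
open import Level using (0ℓ)

-- ℤ[ω] as a commutative ring

⊗-assoc : ∀ x y z → (x ⊗ y) ⊗ z ≡ x ⊗ (y ⊗ z)
⊗-assoc (a + b ω) (c + d ω) (e + f ω) = cong₂ _+_ω (re-assoc a b c d e f) (im-assoc a b c d e f)
  where
  re-assoc : ∀ a b c d e f →
    (a * c - b * d) * e - (a * d +ℤ b * c - b * d) * f ≡ a * (c * e - d * f) - b * (c * f +ℤ d * e - d * f)
  re-assoc = solve-∀
  im-assoc : ∀ a b c d e f →
    (a * c - b * d) * f +ℤ (a * d +ℤ b * c - b * d) * e - (a * d +ℤ b * c - b * d) * f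
      ≡ a * (c * f +ℤ d * e - d * f) +ℤ b * (c * e - d * f) - b * (c * f +ℤ d * e - d * f)
  im-assoc = solve-∀

⊗-comm : ∀ x y → x ⊗ y ≡ y ⊗ x
⊗-comm (a + b ω) (c + d ω) = cong₂ _+_ω (re-comm a b c d) (im-comm a b c d)
  where
  re-comm : ∀ a b c d → a * c - b * d ≡ c * a - d * b
  re-comm = solve-∀
  im-comm : ∀ a b c d → a * d +ℤ b * c - b * d ≡ c * b +ℤ d * a - d * b
  im-comm = solve-∀

⊗-identityˡ : ∀ x → 1𝔼 ⊗ x ≡ x
⊗-identityˡ (a + b ω) = cong₂ _+_ω (re-identity a b) (im-identity a b)
  where
  re-identity : ∀ a b → + 1 * a - + 0 * b ≡ a
  re-identity = solve-∀
  im-identity : ∀ a b → + 1 * b +ℤ + 0 * a - + 0 * b ≡ b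
  im-identity = solve-∀

⊗-identityʳ : ∀ x → x ⊗ 1𝔼 ≡ x
⊗-identityʳ x = trans (⊗-comm x 1𝔼) (⊗-identityˡ x)

⊗-distribˡ-⊕ : ∀ x y z → x ⊗ (y ⊕ z) ≡ (x ⊗ y) ⊕ (x ⊗ z)
⊗-distribˡ-⊕ (a + b ω) (c + d ω) (e + f ω) = cong₂ _+_ω (re-distrib a b c d e f) (im-distrib a b c d e f)
  where
  re-distrib : ∀ a b c d e f → a * (c +ℤ e) - b * (d +ℤ f) ≡ (a * c - b * d) +ℤ (a * e - b * f)
  re-distrib = solve-∀
  im-distrib : ∀ a b c d e f →
    a * (d +ℤ f) +ℤ b * (c +ℤ e) - b * (d +ℤ f) ≡ (a * d +ℤ b * c - b * d) +ℤ (a * f +ℤ b * e - b * f)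
  im-distrib = solve-∀

⊗-distribˡ-⊖ : ∀ x y z → x ⊗ (y ⊖ z) ≡ (x ⊗ y) ⊖ (x ⊗ z)
⊗-distribˡ-⊖ (a + b ω) (c + d ω) (e + f ω) = cong₂ _+_ω (re-distrib a b c d e f) (im-distrib a b c d e f)
  where
  re-distrib : ∀ a b c d e f → a * (c +ℤ - e) - b * (d +ℤ - f) ≡ (a * c - b * d) +ℤ - (a * e - b * f)
  re-distrib = solve-∀
  im-distrib : ∀ a b c d e f →
    a * (d +ℤ - f) +ℤ b * (c +ℤ - e) - b * (d +ℤ - f) ≡ (a * d +ℤ b * c - b * d) +ℤ - (a * f +ℤ b * e - b * f)
  im-distrib = solve-∀

x⊖x≡0 : ∀ x → x ⊖ x ≡ 0𝔼
x⊖x≡0 (a + b ω) = cong₂ _+_ω (ℤ.+-inverseʳ a) (ℤ.+-inverseʳ b)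

x⊖y≡0⇒x≡y : ∀ x y → x ⊖ y ≡ 0𝔼 → x ≡ y
x⊖y≡0⇒x≡y (a + b ω) (c + d ω) eq =
  cong₂ _+_ω (ℤ.i-j≡0⇒i≡j a c (cong re eq)) (ℤ.i-j≡0⇒i≡j b d (cong im eq))

⊗-isCommutativeSemigroup : IsCommutativeSemigroup _⊗_
⊗-isCommutativeSemigroup = record
  { isSemigroup = record
    { isMagma = record { isEquivalence = isEquivalence ; ∙-cong = cong₂ _⊗_ }
    ; assoc = ⊗-assoc
    }
  ; comm = ⊗-comm
  }

⊗-commutativeSemigroup : CommutativeSemigroup 0ℓ 0ℓ
⊗-commutativeSemigroup = record { isCommutativeSemigroup = ⊗-isCommutativeSemigroup }

open import Algebra.Properties.CommutativeSemigroup ⊗-commutativeSemigroup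
  using (x∙yz≈y∙xz; xy∙z≈y∙xz; x∙yz≈z∙xy)

^𝔼-distribˡ-+-⊗ : ∀ x m n → x ^𝔼 (m ℕ.+ n) ≡ (x ^𝔼 m) ⊗ (x ^𝔼 n)
^𝔼-distribˡ-+-⊗ x zero n = sym (⊗-identityˡ (x ^𝔼 n))
^𝔼-distribˡ-+-⊗ x (suc m) n =
  trans (cong (x ⊗_) (^𝔼-distribˡ-+-⊗ x m n)) (sym (⊗-assoc x (x ^𝔼 m) (x ^𝔼 n)))

N-⊗ : ∀ x y → N (x ⊗ y) ≡ N x * N y
N-⊗ (a + b ω) (c + d ω) = N-multiplicative a b c d
  where
  N-multiplicative : ∀ a b c d →
    (a * c - b * d) * (a * c - b * d) - (a * c - b * d) * (a * d +ℤ b * c - b * d)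
      +ℤ (a * d +ℤ b * c - b * d) * (a * d +ℤ b * c - b * d)
    ≡ (a * a - a * b +ℤ b * b) * (c * c - c * d +ℤ d * d)
  N-multiplicative = solve-∀

-- Norm and units

i*i≡+∣i∣*∣i∣ : ∀ i → i * i ≡ + (∣ i ∣ ℕ.* ∣ i ∣)
i*i≡+∣i∣*∣i∣ (+ n)    = ℤ.+◃n≡+n (n ℕ.* n)
i*i≡+∣i∣*∣i∣ -[1+ n ] = refl

4N≡sum-of-squares : ∀ a b →
  + 4 * N (a + b ω) ≡ + (∣ + 2 * a - b ∣ ℕ.* ∣ + 2 * a - b ∣ ℕ.+ 3 ℕ.* (∣ b ∣ ℕ.* ∣ b ∣))
4N≡sum-of-squares a b = begin
  + 4 * N (a + b ω)                      ≡⟨ complete-square a b ⟩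
  (+ 2 * a - b) * (+ 2 * a - b) +ℤ + 3 * (b * b)
    ≡⟨ cong₂ (λ s t → s +ℤ + 3 * t) (i*i≡+∣i∣*∣i∣ (+ 2 * a - b)) (i*i≡+∣i∣*∣i∣ b) ⟩
  + (∣ + 2 * a - b ∣ ℕ.* ∣ + 2 * a - b ∣) +ℤ + 3 * + (∣ b ∣ ℕ.* ∣ b ∣)
    ≡⟨ cong (+ (∣ + 2 * a - b ∣ ℕ.* ∣ + 2 * a - b ∣) +ℤ_) (sym (ℤ.pos-* 3 (∣ b ∣ ℕ.* ∣ b ∣))) ⟩
  + (∣ + 2 * a - b ∣ ℕ.* ∣ + 2 * a - b ∣ ℕ.+ 3 ℕ.* (∣ b ∣ ℕ.* ∣ b ∣)) ∎
  where
  open ≡-Reasoning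
  complete-square : ∀ a b → + 4 * (a * a - a * b +ℤ b * b) ≡ (+ 2 * a - b) * (+ 2 * a - b) +ℤ + 3 * (b * b)
  complete-square = solve-∀

N-swap : ∀ a b → N (a + b ω) ≡ N (b + a ω)
N-swap a b = symmetric a b
  where
  symmetric : ∀ a b → a * a - a * b +ℤ b * b ≡ b * b - b * a +ℤ a * a
  symmetric = solve-∀

0≤N : ∀ x → + 0 ℤ.≤ N x
0≤N (a + b ω) =
  ℤ.*-cancelˡ-≤-pos (+ 0) (N (a + b ω)) (+ 4) (subst (+ 0 ℤ.≤_) (sym (4N≡sum-of-squares a b)) (+≤+ z≤n))

3∣b∣²≤4N : ∀ a b {n} → N (a + b ω) ≡ + n → 3 ℕ.* (∣ b ∣ ℕ.* ∣ b ∣) ℕ.≤ 4 ℕ.* n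
3∣b∣²≤4N a b {n} N≡n = begin
  3 ℕ.* (∣ b ∣ ℕ.* ∣ b ∣)                                     ≤⟨ ℕ.m≤n+m _ (∣ + 2 * a - b ∣ ℕ.* ∣ + 2 * a - b ∣) ⟩
  ∣ + 2 * a - b ∣ ℕ.* ∣ + 2 * a - b ∣ ℕ.+ 3 ℕ.* (∣ b ∣ ℕ.* ∣ b ∣) ≡⟨ cong ∣_∣ (sym (4N≡sum-of-squares a b)) ⟩
  ∣ + 4 * N (a + b ω) ∣                                        ≡⟨ cong (λ m → ∣ + 4 * m ∣) N≡n ⟩
  ∣ + 4 * + n ∣                                                ≡⟨ ℤ.abs-* (+ 4) (+ n) ⟩
  4 ℕ.* n                                                      ∎
  where open ℕ.≤-Reasoning

N≡0⇒≡0𝔼 : ∀ x → N x ≡ + 0 → x ≡ 0𝔼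
N≡0⇒≡0𝔼 (a + b ω) N≡0 = cong₂ _+_ω (im≡0 b a (trans (N-swap b a) N≡0)) (im≡0 a b N≡0)
  where
  im≡0 : ∀ a b → N (a + b ω) ≡ + 0 → b ≡ + 0
  im≡0 a (+ 0)      _   = refl
  im≡0 a (+ suc n)  N≡0 with () ← 3∣b∣²≤4N a (+ suc n) N≡0
  im≡0 a -[1+ n ]   N≡0 with () ← 3∣b∣²≤4N a -[1+ n ] N≡0

IsUnit⇒N≡1 : ∀ u → IsUnit u → N u ≡ + 1
IsUnit⇒N≡1 u (v , uv≡1) = begin
  N u       ≡⟨ sym (ℤ.0≤i⇒+∣i∣≡i (0≤N u)) ⟩
  + ∣ N u ∣ ≡⟨ cong +_ (ℕ.m*n≡1⇒m≡1 ∣ N u ∣ ∣ N v ∣ ∣Nu∣*∣Nv∣≡1) ⟩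
  + 1       ∎
  where
  open ≡-Reasoning
  ∣Nu∣*∣Nv∣≡1 : ∣ N u ∣ ℕ.* ∣ N v ∣ ≡ 1
  ∣Nu∣*∣Nv∣≡1 = trans (sym (ℤ.abs-* (N u) (N v))) (cong ∣_∣ (trans (sym (N-⊗ u v)) (cong N uv≡1)))

data ∣_∣≤1 : ℤ → Set where
  -1≤ : ∣ -[1+ 0 ] ∣≤1
  0≤  : ∣ + 0 ∣≤1
  1≤  : ∣ + 1 ∣≤1

3m²≰4 : ∀ m → 2 ℕ.≤ m → ¬ 3 ℕ.* (m ℕ.* m) ℕ.≤ 4
3m²≰4 m 2≤m le with ℕ.≤-trans (ℕ.*-monoʳ-≤ 3 (ℕ.*-mono-≤ 2≤m 2≤m)) le
... | s≤s (s≤s (s≤s (s≤s ())))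

3∣b∣²≤4⇒∣b∣≤1 : ∀ b → 3 ℕ.* (∣ b ∣ ℕ.* ∣ b ∣) ℕ.≤ 4 → ∣ b ∣≤1
3∣b∣²≤4⇒∣b∣≤1 (+ 0)            _  = 0≤
3∣b∣²≤4⇒∣b∣≤1 (+ 1)            _  = 1≤
3∣b∣²≤4⇒∣b∣≤1 -[1+ 0 ]         _  = -1≤
3∣b∣²≤4⇒∣b∣≤1 (+ suc (suc n))  le = ⊥-elim (3m²≰4 (suc (suc n)) (s≤s (s≤s z≤n)) le)
3∣b∣²≤4⇒∣b∣≤1 -[1+ suc n ]      le = ⊥-elim (3m²≰4 (suc (suc n)) (s≤s (s≤s z≤n)) le)

N≡1⇒∣coordinates∣≤1 : ∀ a b → N (a + b ω) ≡ + 1 → ∣ a ∣≤1 × ∣ b ∣≤1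
N≡1⇒∣coordinates∣≤1 a b N≡1 =
  3∣b∣²≤4⇒∣b∣≤1 a (3∣b∣²≤4N b a (trans (N-swap b a) N≡1)) , 3∣b∣²≤4⇒∣b∣≤1 b (3∣b∣²≤4N a b N≡1)

normalized-associate-unique : ∀ u x → IsUnit u → Normalized x → Normalized (u ⊗ x) → u ≡ 1𝔼
normalized-associate-unique (c + d ω) (a + b ω) u-unit (b<a , 0≤b) =
  unit-cases (N≡1⇒∣coordinates∣≤1 c d N≡1) N≡1
  where
  N≡1 : N (c + d ω) ≡ + 1
  N≡1 = IsUnit⇒N≡1 (c + d ω) u-unit

  slack< : ∀ {i j} → i ℤ.< j → + 0 ℤ.≤ j - (+ 1 +ℤ i)
  slack< i<j = ℤ.i≤j⇒0≤j-i (ℤ.i<j⇒suc[i]≤j i<j)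

  slack≤ : ∀ {i j} → i ℤ.≤ j → + 0 ℤ.≤ j - i
  slack≤ = ℤ.i≤j⇒0≤j-i

  nonnegative≢negative : ∀ {i n} → + 0 ℤ.≤ i → i ≢ -[1+ n ]
  nonnegative≢negative 0≤i refl with () ← 0≤i

  -- In each case the slacks of the inequalities add up to a negative constant.
  unit-cases : ∀ {c d} → ∣ c ∣≤1 × ∣ d ∣≤1 → N (c + d ω) ≡ + 1 →
               Normalized ((c + d ω) ⊗ (a + b ω)) → c + d ω ≡ 1𝔼
  unit-cases (1≤  , 0≤)  _  _               = refl
  unit-cases (0≤  , 0≤)  () _
  unit-cases (1≤  , -1≤) () _
  unit-cases (-1≤ , 1≤)  () _
  unit-cases (-1≤ , 0≤)  _  (lt , _)  =
    ⊥-elim (nonnegative≢negative (ℤ.+-mono-≤ (slack< b<a) (slack< lt)) (minus-one a b))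
    where
    minus-one : ∀ a b → (a - (+ 1 +ℤ b)) +ℤ ((-[1+ 0 ] * a - + 0 * b) - (+ 1 +ℤ (-[1+ 0 ] * b +ℤ + 0 * a - + 0 * b))) ≡ -[1+ 1 ]
    minus-one = solve-∀
  unit-cases (0≤  , 1≤)  _  (lt , _)  =
    ⊥-elim (nonnegative≢negative (ℤ.+-mono-≤ (ℤ.+-mono-≤ (slack< b<a) (slack< lt)) (slack≤ 0≤b)) (omega a b))
    where
    omega : ∀ a b → (a - (+ 1 +ℤ b)) +ℤ ((+ 0 * a - + 1 * b) - (+ 1 +ℤ (+ 0 * b +ℤ + 1 * a - + 1 * b))) +ℤ (b - + 0) ≡ -[1+ 1 ]
    omega = solve-∀
  unit-cases (0≤  , -1≤) _  (_ , nn)  =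
    ⊥-elim (nonnegative≢negative (ℤ.+-mono-≤ (slack< b<a) (slack≤ nn)) (minus-omega a b))
    where
    minus-omega : ∀ a b → (a - (+ 1 +ℤ b)) +ℤ ((+ 0 * b +ℤ -[1+ 0 ] * a - -[1+ 0 ] * b) - + 0) ≡ -[1+ 0 ]
    minus-omega = solve-∀
  unit-cases (-1≤ , -1≤) _  (_ , nn)  =
    ⊥-elim (nonnegative≢negative (ℤ.+-mono-≤ (ℤ.+-mono-≤ (slack< b<a) (slack≤ 0≤b)) (slack≤ nn)) (omega² a b))
    where
    omega² : ∀ a b → (a - (+ 1 +ℤ b)) +ℤ (b - + 0) +ℤ ((-[1+ 0 ] * b +ℤ -[1+ 0 ] * a - -[1+ 0 ] * b) - + 0) ≡ -[1+ 0 ]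
    omega² = solve-∀
  unit-cases (1≤  , 1≤)  _  (lt , _)  =
    ⊥-elim (nonnegative≢negative (ℤ.+-mono-≤ (slack< lt) (slack≤ 0≤b)) (minus-omega² a b))
    where
    minus-omega² : ∀ a b → ((+ 1 * a - + 1 * b) - (+ 1 +ℤ (+ 1 * b +ℤ + 1 * a - + 1 * b))) +ℤ (b - + 0) ≡ -[1+ 0 ]
    minus-omega² = solve-∀

-- Cancellation, divisibility and primes

xy≡xz⇒Nx*N[y⊖z]≡0 : ∀ x y z → x ⊗ y ≡ x ⊗ z → N x ℤ.* N (y ⊖ z) ≡ + 0
xy≡xz⇒Nx*N[y⊖z]≡0 x y z xy≡xz = begin
    N x ℤ.* N (y ⊖ z)     ≡⟨ N-⊗ x (y ⊖ z) ⟨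
    N (x ⊗ (y ⊖ z))       ≡⟨ cong N (⊗-distribˡ-⊖ x y z) ⟩
    N (x ⊗ y ⊖ x ⊗ z)     ≡⟨ cong (λ t → N (x ⊗ y ⊖ t)) xy≡xz ⟨
    N (x ⊗ y ⊖ x ⊗ y)     ≡⟨ cong N (x⊖x≡0 (x ⊗ y)) ⟩
    + 0                   ∎
  where open ≡-Reasoning

⊗-cancelˡ : ∀ x {y z} → x ≢ 0𝔼 → x ⊗ y ≡ x ⊗ z → y ≡ z
⊗-cancelˡ x {y} {z} x≢0 xy≡xz = zero-factor (ℤ.i*j≡0⇒i≡0∨j≡0 (N x) (xy≡xz⇒Nx*N[y⊖z]≡0 x y z xy≡xz))
  where
  zero-factor : N x ≡ + 0 ⊎ N (y ⊖ z) ≡ + 0 → y ≡ z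
  zero-factor (inj₁ Nx≡0)      = ⊥-elim (x≢0 (N≡0⇒≡0𝔼 x Nx≡0))
  zero-factor (inj₂ N[y⊖z]≡0)  = x⊖y≡0⇒x≡y y z (N≡0⇒≡0𝔼 (y ⊖ z) N[y⊖z]≡0)

∣𝔼-refl : ∀ x → x ∣𝔼 x
∣𝔼-refl x = 1𝔼 , sym (⊗-identityˡ x)

∣x⇒∣x⊗y : ∀ {p x} y → p ∣𝔼 x → p ∣𝔼 (x ⊗ y)
∣x⇒∣x⊗y {p} {x} y (q , x≡qp) = q ⊗ y , (begin
  x ⊗ y       ≡⟨ cong (_⊗ y) x≡qp ⟩
  (q ⊗ p) ⊗ y ≡⟨ xy∙z≈y∙xz q p y ⟩
  p ⊗ (q ⊗ y) ≡⟨ ⊗-comm p (q ⊗ y) ⟩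
  (q ⊗ y) ⊗ p ∎)
  where open ≡-Reasoning

∣y⇒∣x⊗y : ∀ {p y} x → p ∣𝔼 y → p ∣𝔼 (x ⊗ y)
∣y⇒∣x⊗y {p} {y} x p∣y = subst (p ∣𝔼_) (⊗-comm y x) (∣x⇒∣x⊗y x p∣y)

x∣x^k : ∀ x {k} → 1 ℕ.≤ k → x ∣𝔼 (x ^𝔼 k)
x∣x^k x {suc k} _ = x ^𝔼 k , ⊗-comm x (x ^𝔼 k)

∣unit⇒unit : ∀ {p u} → p ∣𝔼 u → IsUnit u → IsUnit p
∣unit⇒unit {p} {u} (q , u≡qp) (v , uv≡1) = q ⊗ v , (begin
  p ⊗ (q ⊗ v) ≡⟨ x∙yz≈y∙xz p q v ⟩
  q ⊗ (p ⊗ v) ≡⟨ ⊗-assoc q p v ⟨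
  (q ⊗ p) ⊗ v ≡⟨ cong (_⊗ v) u≡qp ⟨
  u ⊗ v       ≡⟨ uv≡1 ⟩
  1𝔼          ∎)
  where open ≡-Reasoning

prime∣x^n⇒prime∣x : ∀ {p} x n → IsPrime𝔼 p → p ∣𝔼 (x ^𝔼 n) → p ∣𝔼 x
prime∣x^n⇒prime∣x x zero    (_ , p-nonunit , _) p∣1 = ⊥-elim (p-nonunit (∣unit⇒unit p∣1 (1𝔼 , refl)))
prime∣x^n⇒prime∣x x (suc n) p-prime@(_ , _ , euclid) p∣x⊗xⁿ with euclid x (x ^𝔼 n) p∣x⊗xⁿ
... | inj₁ p∣x  = p∣x
... | inj₂ p∣xⁿ = prime∣x^n⇒prime∣x x n p-prime p∣xⁿ

nonunit∣prime⇒associate : ∀ {P π} → IsPrime𝔼 P → ¬ IsUnit π → π ∣𝔼 P → ∃ λ u → IsUnit u × P ≡ u ⊗ π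
nonunit∣prime⇒associate {P} {π} (P≢0 , _ , euclid) π-nonunit (q , P≡qπ)
  with euclid q π (subst (P ∣𝔼_) P≡qπ (∣𝔼-refl P))
... | inj₁ (r , q≡rP) = ⊥-elim (π-nonunit (r , trans (⊗-comm π r) (sym (⊗-cancelˡ P P≢0 P⊗1≡P⊗rπ))))
  where
  open ≡-Reasoning
  P⊗1≡P⊗rπ : P ⊗ 1𝔼 ≡ P ⊗ (r ⊗ π)
  P⊗1≡P⊗rπ = begin
    P ⊗ 1𝔼      ≡⟨ ⊗-identityʳ P ⟩
    P           ≡⟨ P≡qπ ⟩
    q ⊗ π       ≡⟨ cong (_⊗ π) q≡rP ⟩
    (r ⊗ P) ⊗ π ≡⟨ xy∙z≈y∙xz r P π ⟩
    P ⊗ (r ⊗ π) ∎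
... | inj₂ (r , π≡rP) = q , (r , sym (⊗-cancelˡ P P≢0 P⊗1≡P⊗qr)) , P≡qπ
  where
  open ≡-Reasoning
  P⊗1≡P⊗qr : P ⊗ 1𝔼 ≡ P ⊗ (q ⊗ r)
  P⊗1≡P⊗qr = begin
    P ⊗ 1𝔼      ≡⟨ ⊗-identityʳ P ⟩
    P           ≡⟨ P≡qπ ⟩
    q ⊗ π       ≡⟨ cong (q ⊗_) π≡rP ⟩
    q ⊗ (r ⊗ P) ≡⟨ x∙yz≈z∙xy q r P ⟩
    P ⊗ (q ⊗ r) ∎

normalizedPrime∣normalizedPrime⇒≡ : ∀ {π P} → IsPrime𝔼 π → IsPrime𝔼 P → Normalized π → Normalized P →
                                    π ∣𝔼 P → π ≡ P
normalizedPrime∣normalizedPrime⇒≡ {π} {P} (_ , π-nonunit , _) P-prime π-normalized P-normalized π∣P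
  with nonunit∣prime⇒associate P-prime π-nonunit π∣P
... | u , u-unit , P≡uπ = begin
  π       ≡⟨ ⊗-identityˡ π ⟨
  1𝔼 ⊗ π  ≡⟨ cong (_⊗ π) u≡1 ⟨
  u ⊗ π   ≡⟨ P≡uπ ⟨
  P       ∎
  where
  open ≡-Reasoning
  u≡1 : u ≡ 1𝔼
  u≡1 = normalized-associate-unique u π u-unit π-normalized (subst Normalized P≡uπ P-normalized)

-- Geometric sums and factorizations of u pᵃ qᵇ

[y⊖1]⊕[x⊖1]y≡xy⊖1 : ∀ x y → (y ⊖ 1𝔼) ⊕ ((x ⊖ 1𝔼) ⊗ y) ≡ (x ⊗ y) ⊖ 1𝔼
[y⊖1]⊕[x⊖1]y≡xy⊖1 (a + b ω) (c + d ω) = cong₂ _+_ω (re-step a b c d) (im-step a b c d)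
  where
  re-step : ∀ a b c d → (c +ℤ - + 1) +ℤ ((a +ℤ - + 1) * c - (b +ℤ - + 0) * d) ≡ (a * c - b * d) +ℤ - + 1
  re-step = solve-∀
  im-step : ∀ a b c d →
    (d +ℤ - + 0) +ℤ ((a +ℤ - + 1) * d +ℤ (b +ℤ - + 0) * c - (b +ℤ - + 0) * d) ≡ (a * d +ℤ b * c - b * d) +ℤ - + 0
  im-step = solve-∀

[x⊖1]⊗geomSum : ∀ x n → (x ⊖ 1𝔼) ⊗ geomSum x n ≡ x ^𝔼 suc n ⊖ 1𝔼
[x⊖1]⊗geomSum x zero    = trans (⊗-identityʳ (x ⊖ 1𝔼)) (cong (_⊖ 1𝔼) (sym (⊗-identityʳ x)))
[x⊖1]⊗geomSum x (suc n) = begin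
  (x ⊖ 1𝔼) ⊗ (geomSum x n ⊕ x ^𝔼 suc n)                   ≡⟨ ⊗-distribˡ-⊕ (x ⊖ 1𝔼) (geomSum x n) (x ^𝔼 suc n) ⟩
  (x ⊖ 1𝔼) ⊗ geomSum x n ⊕ (x ⊖ 1𝔼) ⊗ x ^𝔼 suc n         ≡⟨ cong (_⊕ (x ⊖ 1𝔼) ⊗ x ^𝔼 suc n) ([x⊖1]⊗geomSum x n) ⟩
  (x ^𝔼 suc n ⊖ 1𝔼) ⊕ (x ⊖ 1𝔼) ⊗ x ^𝔼 suc n              ≡⟨ [y⊖1]⊕[x⊖1]y≡xy⊖1 x (x ^𝔼 suc n) ⟩
  x ^𝔼 suc (suc n) ⊖ 1𝔼                                   ∎
  where open ≡-Reasoning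

prime∤unit⊗x : ∀ {p u x} → IsPrime𝔼 p → IsUnit u → ¬ p ∣𝔼 x → ¬ p ∣𝔼 (u ⊗ x)
prime∤unit⊗x {p} {u} {x} (_ , p-nonunit , euclid) u-unit p∤x p∣ux =
  [ (λ p∣u → p-nonunit (∣unit⇒unit {p} {u} p∣u u-unit)) , p∤x ]′ (euclid u x p∣ux)

p^a⊗y-unique : ∀ {p y y'} a a' → IsPrime𝔼 p → ¬ p ∣𝔼 y → ¬ p ∣𝔼 y' →
               p ^𝔼 a ⊗ y ≡ p ^𝔼 a' ⊗ y' → a ≡ a' × y ≡ y'
p^a⊗y-unique {p} {y} {y'} zero zero _ _ _ eq =
  refl , trans (sym (⊗-identityˡ y)) (trans eq (⊗-identityˡ y'))
p^a⊗y-unique {p} {y} {y'} zero (suc a') _ p∤y _ eq =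
  ⊥-elim (p∤y (p ^𝔼 a' ⊗ y' , trans (sym (⊗-identityˡ y)) (trans eq (trans (⊗-assoc p (p ^𝔼 a') y') (⊗-comm p (p ^𝔼 a' ⊗ y'))))))
p^a⊗y-unique {p} {y} {y'} (suc a) zero _ _ p∤y' eq =
  ⊥-elim (p∤y' (p ^𝔼 a ⊗ y , trans (sym (⊗-identityˡ y')) (trans (sym eq) (trans (⊗-assoc p (p ^𝔼 a) y) (⊗-comm p (p ^𝔼 a ⊗ y))))))
p^a⊗y-unique {p} {y} {y'} (suc a) (suc a') p-prime p∤y p∤y' eq =
  map₁ (cong suc) (p^a⊗y-unique a a' p-prime p∤y p∤y'
    (⊗-cancelˡ p (proj₁ p-prime) (trans (sym (⊗-assoc p (p ^𝔼 a) y)) (trans eq (⊗-assoc p (p ^𝔼 a') y')))))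

factors∣primePart : ∀ (f : Factorization) → All (λ { (_ , k) → 1 ℕ.≤ k }) f → All (λ { (π , _) → π ∣𝔼 primePart f }) f
factors∣primePart []            []          = []
factors∣primePart ((π , k) ∷ f) (1≤k ∷ 1≤f) =
  ∣x⇒∣x⊗y (primePart f) (x∣x^k π 1≤k) ∷ All.map (∣y⇒∣x⊗y (π ^𝔼 k)) (factors∣primePart f 1≤f)

module TwoPrimePowers {p q : 𝔼} (p-prime : IsPrime𝔼 p) (q-prime : IsPrime𝔼 q)
                      (p-normalized : Normalized p) (q-normalized : Normalized q) (p≢q : p ≢ q) where

  p∤q^b : ∀ b → ¬ p ∣𝔼 (q ^𝔼 b)
  p∤q^b b p∣qᵇ = p≢q (normalizedPrime∣normalizedPrime⇒≡ p-prime q-prime p-normalized q-normalized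
                        (prime∣x^n⇒prime∣x q b p-prime p∣qᵇ))

  q∤unit : ∀ u → IsUnit u → ¬ q ∣𝔼 u
  q∤unit u u-unit q∣u = proj₁ (proj₂ q-prime) (∣unit⇒unit {q} {u} q∣u u-unit)

  exponents-unique : ∀ u u' a b a' b' → IsUnit u → IsUnit u' →
                     u ⊗ (p ^𝔼 a ⊗ q ^𝔼 b) ≡ u' ⊗ (p ^𝔼 a' ⊗ q ^𝔼 b') → a ≡ a' × b ≡ b'
  exponents-unique u u' a b a' b' u-unit u'-unit eq = a≡a' , b≡b'
    where
    p-exponents : a ≡ a' × u ⊗ q ^𝔼 b ≡ u' ⊗ q ^𝔼 b'
    p-exponents = p^a⊗y-unique a a' p-prime
      (prime∤unit⊗x {p} {u} p-prime u-unit (p∤q^b b)) (prime∤unit⊗x {p} {u'} p-prime u'-unit (p∤q^b b'))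
      (trans (sym (x∙yz≈y∙xz u (p ^𝔼 a) (q ^𝔼 b))) (trans eq (x∙yz≈y∙xz u' (p ^𝔼 a') (q ^𝔼 b'))))
    a≡a' : a ≡ a'
    a≡a' = proj₁ p-exponents
    b≡b' : b ≡ b'
    b≡b' = proj₁ (p^a⊗y-unique b b' q-prime (q∤unit u u-unit) (q∤unit u' u'-unit)
                   (trans (⊗-comm (q ^𝔼 b) u) (trans (proj₂ p-exponents) (⊗-comm u' (q ^𝔼 b')))))

  prime-divisor : ∀ {π} u a b → IsPrime𝔼 π → Normalized π → IsUnit u →
                  π ∣𝔼 (u ⊗ (p ^𝔼 a ⊗ q ^𝔼 b)) → π ≡ p ⊎ π ≡ q
  prime-divisor {π} u a b π-prime@(_ , π-nonunit , euclid) π-normalized u-unit π∣upᵃqᵇ =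
    [ (λ π∣u → ⊥-elim (π-nonunit (∣unit⇒unit {π} {u} π∣u u-unit))) ,
      (λ π∣pᵃqᵇ → Sum.map (equal-to p p-prime p-normalized a) (equal-to q q-prime q-normalized b)
                          (euclid (p ^𝔼 a) (q ^𝔼 b) π∣pᵃqᵇ)) ]′
    (euclid u (p ^𝔼 a ⊗ q ^𝔼 b) π∣upᵃqᵇ)
    where
    equal-to : ∀ r → IsPrime𝔼 r → Normalized r → ∀ n → π ∣𝔼 (r ^𝔼 n) → π ≡ r
    equal-to r r-prime r-normalized n π∣rⁿ =
      normalizedPrime∣normalizedPrime⇒≡ π-prime r-prime π-normalized r-normalized (prime∣x^n⇒prime∣x r n π-prime π∣rⁿ)

  PowersOf-p-q : Factorization → Set
  PowersOf-p-q f = Σ ℕ λ a → Σ ℕ λ b → primePart f ≡ p ^𝔼 a ⊗ q ^𝔼 b × σ⋆ f ≡ geomSum p a ⊗ geomSum q b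

  no-three-distinct : ∀ {x y z} → x ≡ p ⊎ x ≡ q → y ≡ p ⊎ y ≡ q → z ≡ p ⊎ z ≡ q →
                      x ≢ y → x ≢ z → y ≢ z → ⊥
  no-three-distinct (inj₁ refl) (inj₁ refl) _           x≢y _   _   = x≢y refl
  no-three-distinct (inj₂ refl) (inj₂ refl) _           x≢y _   _   = x≢y refl
  no-three-distinct (inj₁ refl) _           (inj₁ refl) _   x≢z _   = x≢z refl
  no-three-distinct (inj₂ refl) _           (inj₂ refl) _   x≢z _   = x≢z refl
  no-three-distinct _           (inj₁ refl) (inj₁ refl) _   _   y≢z = y≢z refl
  no-three-distinct _           (inj₂ refl) (inj₂ refl) _   _   y≢z = y≢z refl

  distinct⇒PowersOf-p-q : ∀ f → All (λ e → proj₁ e ≡ p ⊎ proj₁ e ≡ q) f → Unique (map proj₁ f) → PowersOf-p-q f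
  distinct⇒PowersOf-p-q [] [] _ = 0 , 0 , refl , refl
  distinct⇒PowersOf-p-q ((_ , k) ∷ []) (inj₁ refl ∷ []) _ = k , 0 , refl , refl
  distinct⇒PowersOf-p-q ((_ , k) ∷ []) (inj₂ refl ∷ []) _ = 0 , k , ⊗-comm (q ^𝔼 k) 1𝔼 , ⊗-comm (geomSum q k) 1𝔼
  distinct⇒PowersOf-p-q ((_ , k) ∷ (_ , l) ∷ []) (inj₁ refl ∷ inj₂ refl ∷ []) _ =
    k , l , cong (p ^𝔼 k ⊗_) (⊗-identityʳ (q ^𝔼 l)) , cong (geomSum p k ⊗_) (⊗-identityʳ (geomSum q l))
  distinct⇒PowersOf-p-q ((_ , k) ∷ (_ , l) ∷ []) (inj₂ refl ∷ inj₁ refl ∷ []) _ =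
    l , k , trans (cong (q ^𝔼 k ⊗_) (⊗-identityʳ (p ^𝔼 l))) (⊗-comm (q ^𝔼 k) (p ^𝔼 l)) ,
            trans (cong (geomSum q k ⊗_) (⊗-identityʳ (geomSum p l))) (⊗-comm (geomSum q k) (geomSum p l))
  distinct⇒PowersOf-p-q (_ ∷ _ ∷ []) (inj₁ refl ∷ inj₁ refl ∷ []) ((p≢p ∷ []) ∷ _) = ⊥-elim (p≢p refl)
  distinct⇒PowersOf-p-q (_ ∷ _ ∷ []) (inj₂ refl ∷ inj₂ refl ∷ []) ((q≢q ∷ []) ∷ _) = ⊥-elim (q≢q refl)
  distinct⇒PowersOf-p-q (_ ∷ _ ∷ _ ∷ _) (m₁ ∷ m₂ ∷ m₃ ∷ _) ((≢₁₂ ∷ ≢₁₃ ∷ _) ∷ (≢₂₃ ∷ _) ∷ _) =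
    ⊥-elim (no-three-distinct m₁ m₂ m₃ ≢₁₂ ≢₁₃ ≢₂₃)

  factors-are-p-or-q : ∀ u a b f → IsUnit u → IsFactorizationOf f (u ⊗ (p ^𝔼 a ⊗ q ^𝔼 b)) →
                       All (λ e → proj₁ e ≡ p ⊎ proj₁ e ≡ q) f
  factors-are-p-or-q u a b f u-unit (factors , _ , ε , _ , upᵃqᵇ≡εf) =
    All.zipWith p-or-q (factors , factors∣primePart f (All.map (λ fac → proj₂ (proj₂ fac)) factors))
    where
    p-or-q : ∀ {e} → (IsPrime𝔼 (proj₁ e) × Normalized (proj₁ e) × 1 ℕ.≤ proj₂ e) × proj₁ e ∣𝔼 primePart f →
             proj₁ e ≡ p ⊎ proj₁ e ≡ q
    p-or-q {e} ((π-prime , π-normalized , _) , π∣f) =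
      prime-divisor u a b π-prime π-normalized u-unit (subst (proj₁ e ∣𝔼_) (sym upᵃqᵇ≡εf) (∣y⇒∣x⊗y ε π∣f))

  σ⋆-unique : ∀ u a b f → IsUnit u → IsFactorizationOf f (u ⊗ (p ^𝔼 a ⊗ q ^𝔼 b)) →
              σ⋆ f ≡ geomSum p a ⊗ geomSum q b
  σ⋆-unique u a b f u-unit fac@(_ , unique , ε , ε-unit , upᵃqᵇ≡εf) =
    from-shape (distinct⇒PowersOf-p-q f (factors-are-p-or-q u a b f u-unit fac) unique)
    where
    from-shape : PowersOf-p-q f → σ⋆ f ≡ geomSum p a ⊗ geomSum q b
    from-shape (a' , b' , f≡pᵃ'qᵇ' , σ⋆≡) =
      subst₂ (λ a b → σ⋆ f ≡ geomSum p a ⊗ geomSum q b) a'≡a b'≡b σ⋆≡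
      where
      exponents : a' ≡ a × b' ≡ b
      exponents = exponents-unique ε u a' b' a b ε-unit u-unit (trans (cong (ε ⊗_) (sym f≡pᵃ'qᵇ')) (sym upᵃqᵇ≡εf))
      a'≡a = proj₁ exponents
      b'≡b = proj₂ exponents

  factorization : ∀ u a b → 1 ℕ.≤ a → 1 ℕ.≤ b → IsUnit u →
                  IsFactorizationOf ((p , a) ∷ (q , b) ∷ []) (u ⊗ (p ^𝔼 a ⊗ q ^𝔼 b))
  factorization u a b 1≤a 1≤b u-unit =
    (p-prime , p-normalized , 1≤a) ∷ (q-prime , q-normalized , 1≤b) ∷ [] ,
    (p≢q ∷ []) ∷ [] ∷ [] ,
    u , u-unit , cong (λ x → u ⊗ (p ^𝔼 a ⊗ x)) (sym (⊗-identityʳ (q ^𝔼 b)))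

  normPerfect : ∀ u a b → 1 ℕ.≤ a → 1 ℕ.≤ b → IsUnit u →
                N (geomSum p a ⊗ geomSum q b) ≡ + 3 ℤ.* N (u ⊗ (p ^𝔼 a ⊗ q ^𝔼 b)) →
                NormPerfect (u ⊗ (p ^𝔼 a ⊗ q ^𝔼 b))
  normPerfect u a b 1≤a 1≤b u-unit N[σ⋆]≡3N =
    (_ , factorization u a b 1≤a 1≤b u-unit) ,
    λ f fac → trans (cong N (σ⋆-unique u a b f u-unit fac)) N[σ⋆]≡3N

-- The prime above 3

π₃ : 𝔼
π₃ = (+ 2) + (+ 1) ω

π₃∣⇒3∣re+im : ∀ x → π₃ ∣𝔼 x → + 3 ℤ.∣ re x +ℤ im x
π₃∣⇒3∣re+im _ (c + d ω , refl) = divides c (re+im c d)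
  where
  re+im : ∀ c d → (c * + 2 - d * + 1) +ℤ (c * + 1 +ℤ d * + 2 - d * + 1) ≡ c * + 3
  re+im = solve-∀

3∣re+im⇒π₃∣ : ∀ x → + 3 ℤ.∣ re x +ℤ im x → π₃ ∣𝔼 x
3∣re+im⇒π₃∣ (a + b ω) (divides c a+b≡3c) = c + (b - c) ω , cong₂ _+_ω (re-eq a b c a+b≡3c) (im-eq b c)
  where
  re-eq : ∀ a b c → a +ℤ b ≡ c * + 3 → a ≡ c * + 2 - (b - c) * + 1
  re-eq a b c a+b≡3c = trans (a≡[a+b]-b a b) (trans (cong (_- b) a+b≡3c) (3c-b a b c))
    where
    a≡[a+b]-b : ∀ a b → a ≡ (a +ℤ b) - b
    a≡[a+b]-b = solve-∀
    3c-b : ∀ a b c → c * + 3 - b ≡ c * + 2 - (b - c) * + 1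
    3c-b = solve-∀
  im-eq : ∀ b c → b ≡ c * + 1 +ℤ (b - c) * + 2 - (b - c) * + 1
  im-eq = solve-∀

3∣i*j⇒3∣i⊎3∣j : ∀ i j → + 3 ℤ.∣ i * j → + 3 ℤ.∣ i ⊎ + 3 ℤ.∣ j
3∣i*j⇒3∣i⊎3∣j i j 3∣ij
  with euclidsLemma ℤ.∣ i ∣ ℤ.∣ j ∣ (toWitness {a? = prime? 3} _)
         (subst (3 ℕ.∣_) (ℤ.abs-* i j) (ℤ.∣⇒∣ᵤ 3∣ij))
... | inj₁ 3∣i = inj₁ (ℤ.∣ᵤ⇒∣ 3∣i)
... | inj₂ 3∣j = inj₂ (ℤ.∣ᵤ⇒∣ 3∣j)

3∤1 : ¬ + 3 ℤ.∣ + 1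
3∤1 3∣1 with () ← ℕ.∣1⇒≡1 (ℤ.∣⇒∣ᵤ 3∣1)

π₃-prime : IsPrime𝔼 π₃
π₃-prime = (λ ()) , π₃-nonunit , euclid
  where
  π₃-nonunit : ¬ IsUnit π₃
  π₃-nonunit (v , π₃v≡1) = 3∤1 (π₃∣⇒3∣re+im 1𝔼 (v , trans (sym π₃v≡1) (⊗-comm π₃ v)))
  -- re + im is multiplicative modulo 3
  re+im-⊗ : ∀ a b c d → (a +ℤ b) * (c +ℤ d) ≡ ((a * c - b * d) +ℤ (a * d +ℤ b * c - b * d)) +ℤ (b * d) * + 3
  re+im-⊗ = solve-∀
  euclid : ∀ x y → π₃ ∣𝔼 (x ⊗ y) → π₃ ∣𝔼 x ⊎ π₃ ∣𝔼 y
  euclid (a + b ω) (c + d ω) π₃∣xy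
    with 3∣i*j⇒3∣i⊎3∣j (a +ℤ b) (c +ℤ d)
           (subst (+ 3 ℤ.∣_) (sym (re+im-⊗ a b c d)) (ℤ.∣m∣n⇒∣m+n (π₃∣⇒3∣re+im _ π₃∣xy) (divides (b * d) refl)))
  ... | inj₁ 3∣a+b = inj₁ (3∣re+im⇒π₃∣ _ 3∣a+b)
  ... | inj₂ 3∣c+d = inj₂ (3∣re+im⇒π₃∣ _ 3∣c+d)

π₃-normalized : Normalized π₃
π₃-normalized = +<+ (s≤s (s≤s z≤n)) , +≤+ z≤n

-- Powers of λ𝔼 and π₃, and the Mersenne family

ι : ℤ → 𝔼
ι t = t + (+ 0) ω

[a+bω]⊗ι : ∀ a b t → (a + b ω) ⊗ ι t ≡ (a * t) + (b * t) ω
[a+bω]⊗ι a b t = cong₂ _+_ω (re-eq a b t) (im-eq a b t)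
  where
  re-eq : ∀ a b t → a * t - b * + 0 ≡ a * t
  re-eq = solve-∀
  im-eq : ∀ a b t → a * + 0 +ℤ b * t - b * + 0 ≡ b * t
  im-eq = solve-∀

^𝔼-periodic : ∀ x c r q → x ^𝔼 12 ≡ ι (+ c) → x ^𝔼 (r ℕ.+ q ℕ.* 12) ≡ x ^𝔼 r ⊗ ι (+ (c ℕ.^ q))
^𝔼-periodic x c r q x¹²≡c = trans (^𝔼-distribˡ-+-⊗ x r (q ℕ.* 12)) (cong (x ^𝔼 r ⊗_) (x^[q*12] q))
  where
  x^[q*12] : ∀ q → x ^𝔼 (q ℕ.* 12) ≡ ι (+ (c ℕ.^ q))
  x^[q*12] zero    = refl
  x^[q*12] (suc q) = begin
    x ^𝔼 (12 ℕ.+ q ℕ.* 12)               ≡⟨ ^𝔼-distribˡ-+-⊗ x 12 (q ℕ.* 12) ⟩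
    x ^𝔼 12 ⊗ x ^𝔼 (q ℕ.* 12)            ≡⟨ cong₂ _⊗_ x¹²≡c (x^[q*12] q) ⟩
    ι (+ c) ⊗ ι (+ (c ℕ.^ q))             ≡⟨ [a+bω]⊗ι (+ c) (+ 0) (+ (c ℕ.^ q)) ⟩
    ι (+ c * + (c ℕ.^ q))                 ≡⟨ cong ι (ℤ.pos-* c (c ℕ.^ q)) ⟨
    ι (+ (c ℕ.^ suc q))                   ∎
    where open ≡-Reasoning

-- λ𝔼¹² = π₃¹² = 729, λ𝔼¹⁰ = 243 (1 + ω) and π₃¹⁰ = -243 ω.
T : ℕ → ℤ
T q = + 243 * + (729 ℕ.^ q)

1<T : ∀ q → + 1 ℤ.< T q
1<T q = subst (+ 1 ℤ.<_) (ℤ.pos-* 243 (729 ℕ.^ q))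
          (+<+ (ℕ.≤-trans (s≤s (s≤s z≤n)) (ℕ.m≤m*n 243 (729 ℕ.^ q) {{ℕ.m^n≢0 729 q}})))

λ𝔼^[10+12q] : ∀ q → λ𝔼 ^𝔼 (10 ℕ.+ q ℕ.* 12) ≡ T q + T q ω
λ𝔼^[10+12q] q = trans (^𝔼-periodic λ𝔼 729 10 q refl) ([a+bω]⊗ι (+ 243) (+ 243) (+ (729 ℕ.^ q)))

π₃^[10+12q] : ∀ q → π₃ ^𝔼 (10 ℕ.+ q ℕ.* 12) ≡ (+ 0) + (- T q) ω
π₃^[10+12q] q = trans (^𝔼-periodic π₃ 729 10 q refl)
  (trans ([a+bω]⊗ι (+ 0) (- + 243) c) (cong ((+ 0) +_ω) (sym (ℤ.neg-distribˡ-* (+ 243) c))))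
  where c = + (729 ℕ.^ q)

mersenne : ℤ → 𝔼
mersenne t = (+ 2 * t - + 1) + t ω

mersenne-normalized : ∀ {t} → + 1 ℤ.< t → Normalized (mersenne t)
mersenne-normalized {t} 1<t = t<2t-1 , ℤ.<⇒≤ (ℤ.<-trans (+<+ (s≤s z≤n)) 1<t)
  where
  open ℤ.≤-Reasoning
  t<2t-1 : t ℤ.< + 2 * t - + 1
  t<2t-1 = begin-strict
    t                    ≡⟨ [1+t]-1 t ⟨
    (+ 1 +ℤ t) - + 1     <⟨ ℤ.+-monoˡ-< (- + 1) (ℤ.+-monoˡ-< t 1<t) ⟩
    (t +ℤ t) - + 1       ≡⟨ [t+t]-1 t ⟩
    + 2 * t - + 1        ∎
    where
    [1+t]-1 : ∀ t → (+ 1 +ℤ t) - + 1 ≡ t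
    [1+t]-1 = solve-∀
    [t+t]-1 : ∀ t → (t +ℤ t) - + 1 ≡ + 2 * t - + 1
    [t+t]-1 = solve-∀

ω𝔼-unit : IsUnit ω𝔼
ω𝔼-unit = (- + 1) + (- + 1) ω , refl

ω𝔼⊗[-tω] : ∀ t → ω𝔼 ⊗ ((+ 0) + (- t) ω) ≡ t + t ω
ω𝔼⊗[-tω] t = cong₂ _+_ω (re-eq t) (im-eq t)
  where
  re-eq : ∀ t → + 0 * + 0 - + 1 * (- t) ≡ t
  re-eq = solve-∀
  im-eq : ∀ t → + 0 * (- t) +ℤ + 1 * + 0 - + 1 * (- t) ≡ t
  im-eq = solve-∀

-- N (π₃ ⊖ 1𝔼) = N (1 + ω) reduces to + 1.
N-geomSum-π₃ : ∀ e → N (geomSum π₃ e) ≡ N (π₃ ^𝔼 suc e ⊖ 1𝔼)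
N-geomSum-π₃ e = begin
  N (geomSum π₃ e)                   ≡⟨ ℤ.*-identityˡ (N (geomSum π₃ e)) ⟨
  N (π₃ ⊖ 1𝔼) * N (geomSum π₃ e)     ≡⟨ N-⊗ (π₃ ⊖ 1𝔼) (geomSum π₃ e) ⟨
  N ((π₃ ⊖ 1𝔼) ⊗ geomSum π₃ e)       ≡⟨ cong N ([x⊖1]⊗geomSum π₃ e) ⟩
  N (π₃ ^𝔼 suc e ⊖ 1𝔼)               ∎
  where open ≡-Reasoning

geomSum-1 : ∀ x → geomSum x 1 ≡ 1𝔼 ⊕ x
geomSum-1 x = cong (1𝔼 ⊕_) (⊗-identityʳ x)

N[t-tω-1]*N[1+mersenne]≡3N[t+tω]*N[mersenne] : ∀ t →
  N ((t + (- t) ω) ⊖ 1𝔼) * N (1𝔼 ⊕ mersenne t) ≡ + 3 * (N (t + t ω) * N (mersenne t))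
N[t-tω-1]*N[1+mersenne]≡3N[t+tω]*N[mersenne] = identity
  where
  -- N unfolded by hand: the ring solver does not reduce it.
  identity : ∀ t →
    ((t +ℤ - + 1) * (t +ℤ - + 1) - (t +ℤ - + 1) * (- t +ℤ - + 0) +ℤ (- t +ℤ - + 0) * (- t +ℤ - + 0))
    * ((+ 1 +ℤ (+ 2 * t - + 1)) * (+ 1 +ℤ (+ 2 * t - + 1)) - (+ 1 +ℤ (+ 2 * t - + 1)) * (+ 0 +ℤ t) +ℤ (+ 0 +ℤ t) * (+ 0 +ℤ t))
    ≡ + 3 * ((t * t - t * t +ℤ t * t) * ((+ 2 * t - + 1) * (+ 2 * t - + 1) - (+ 2 * t - + 1) * t +ℤ t * t))
  identity = solve-∀

EvenNormPerfectIfMersennePrime : ℕ → Set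
EvenNormPerfectIfMersennePrime k = IsEisensteinMersennePrime ((λ𝔼 ^𝔼 k) ⊖ 1𝔼) →
  Even ((λ𝔼 ^𝔼 (k ∸ 1)) ⊗ ((λ𝔼 ^𝔼 k) ⊖ 1𝔼)) × NormPerfect ((λ𝔼 ^𝔼 (k ∸ 1)) ⊗ ((λ𝔼 ^𝔼 k) ⊖ 1𝔼))

module MersenneFamily (e : ℕ) (1≤e : 1 ℕ.≤ e) (t : ℤ) (1<t : + 1 ℤ.< t)
                      (λ𝔼ᵉ≡t+tω : λ𝔼 ^𝔼 e ≡ t + t ω) (π₃ᵉ≡-tω : π₃ ^𝔼 e ≡ (+ 0) + (- t) ω) where

  M : 𝔼
  M = λ𝔼 ^𝔼 suc e ⊖ 1𝔼

  M≡mersenne : M ≡ mersenne t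
  M≡mersenne = begin
    λ𝔼 ⊗ λ𝔼 ^𝔼 e ⊖ 1𝔼       ≡⟨ cong (λ x → λ𝔼 ⊗ x ⊖ 1𝔼) λ𝔼ᵉ≡t+tω ⟩
    λ𝔼 ⊗ (t + t ω) ⊖ 1𝔼     ≡⟨ cong₂ _+_ω (re-eq t) (im-eq t) ⟩
    mersenne t              ∎
    where
    open ≡-Reasoning
    re-eq : ∀ t → (+ 1 +ℤ - + 0) * t - (+ 0 +ℤ - + 1) * t +ℤ - + 1 ≡ + 2 * t - + 1
    re-eq = solve-∀
    im-eq : ∀ t → (+ 1 +ℤ - + 0) * t +ℤ (+ 0 +ℤ - + 1) * t - (+ 0 +ℤ - + 1) * t +ℤ - + 0 ≡ t
    im-eq = solve-∀

  π₃^[1+e]≡t-tω : π₃ ^𝔼 suc e ≡ t + (- t) ω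
  π₃^[1+e]≡t-tω = trans (cong (π₃ ⊗_) π₃ᵉ≡-tω) (cong₂ _+_ω (re-eq t) (im-eq t))
    where
    re-eq : ∀ t → + 2 * + 0 - + 1 * (- t) ≡ t
    re-eq = solve-∀
    im-eq : ∀ t → + 2 * (- t) +ℤ + 1 * + 0 - + 1 * (- t) ≡ - t
    im-eq = solve-∀

  M-normalized : Normalized M
  M-normalized = subst Normalized (sym M≡mersenne) (mersenne-normalized 1<t)

  π₃≢M : π₃ ≢ M
  π₃≢M π₃≡M = ℤ.<-irrefl (cong im (trans π₃≡M M≡mersenne)) 1<t

  λ𝔼ᵉ⊗M≡ω⊗π₃ᵉ⊗M : λ𝔼 ^𝔼 e ⊗ M ≡ ω𝔼 ⊗ (π₃ ^𝔼 e ⊗ M ^𝔼 1)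
  λ𝔼ᵉ⊗M≡ω⊗π₃ᵉ⊗M = begin
    λ𝔼 ^𝔼 e ⊗ M                  ≡⟨ cong (_⊗ M) λ𝔼ᵉ≡t+tω ⟩
    (t + t ω) ⊗ M                ≡⟨ cong (_⊗ M) (ω𝔼⊗[-tω] t) ⟨
    (ω𝔼 ⊗ ((+ 0) + (- t) ω)) ⊗ M ≡⟨ cong (λ x → (ω𝔼 ⊗ x) ⊗ M) π₃ᵉ≡-tω ⟨
    (ω𝔼 ⊗ π₃ ^𝔼 e) ⊗ M           ≡⟨ ⊗-assoc ω𝔼 (π₃ ^𝔼 e) M ⟩
    ω𝔼 ⊗ (π₃ ^𝔼 e ⊗ M)           ≡⟨ cong (λ x → ω𝔼 ⊗ (π₃ ^𝔼 e ⊗ x)) (⊗-identityʳ M) ⟨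
    ω𝔼 ⊗ (π₃ ^𝔼 e ⊗ M ^𝔼 1)      ∎
    where open ≡-Reasoning

  N[σ⋆]≡3N : N (geomSum π₃ e ⊗ geomSum M 1) ≡ + 3 * N (ω𝔼 ⊗ (π₃ ^𝔼 e ⊗ M ^𝔼 1))
  N[σ⋆]≡3N = begin
    N (geomSum π₃ e ⊗ geomSum M 1)                    ≡⟨ N-⊗ (geomSum π₃ e) (geomSum M 1) ⟩
    N (geomSum π₃ e) * N (geomSum M 1)                ≡⟨ cong₂ _*_ (N-geomSum-π₃ e) (cong N (geomSum-1 M)) ⟩
    N (π₃ ^𝔼 suc e ⊖ 1𝔼) * N (1𝔼 ⊕ M)                 ≡⟨ cong₂ (λ x y → N (x ⊖ 1𝔼) * N (1𝔼 ⊕ y)) π₃^[1+e]≡t-tω M≡mersenne ⟩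
    N ((t + (- t) ω) ⊖ 1𝔼) * N (1𝔼 ⊕ mersenne t)      ≡⟨ N[t-tω-1]*N[1+mersenne]≡3N[t+tω]*N[mersenne] t ⟩
    + 3 * (N (t + t ω) * N (mersenne t))              ≡⟨ cong₂ (λ x y → + 3 * (N x * N y)) λ𝔼ᵉ≡t+tω M≡mersenne ⟨
    + 3 * (N (λ𝔼 ^𝔼 e) * N M)                         ≡⟨ cong (+ 3 *_) (N-⊗ (λ𝔼 ^𝔼 e) M) ⟨
    + 3 * N (λ𝔼 ^𝔼 e ⊗ M)                             ≡⟨ cong (λ x → + 3 * N x) λ𝔼ᵉ⊗M≡ω⊗π₃ᵉ⊗M ⟩
    + 3 * N (ω𝔼 ⊗ (π₃ ^𝔼 e ⊗ M ^𝔼 1))                 ∎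
    where open ≡-Reasoning

  even : Even (λ𝔼 ^𝔼 e ⊗ M)
  even = ∣x⇒∣x⊗y M (x∣x^k λ𝔼 1≤e)

  normPerfect : IsPrime𝔼 M → NormPerfect (λ𝔼 ^𝔼 e ⊗ M)
  normPerfect M-prime = subst NormPerfect (sym λ𝔼ᵉ⊗M≡ω⊗π₃ᵉ⊗M)
    (TwoPrimePowers.normPerfect π₃-prime M-prime π₃-normalized M-normalized π₃≢M
      ω𝔼 e 1 1≤e (s≤s z≤n) ω𝔼-unit N[σ⋆]≡3N)

  evenNormPerfect : EvenNormPerfectIfMersennePrime (suc e)
  evenNormPerfect (_ , _ , _ , M-prime) = even , normPerfect M-prime

theorem4p3 : (k : ℕ) → 1 < k → k % 12 ≡ 11 →
    IsEisensteinMersennePrime ((λ𝔼 ^𝔼 k) ⊖ 1𝔼) →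
    Even ((λ𝔼 ^𝔼 (k ∸ 1)) ⊗ ((λ𝔼 ^𝔼 k) ⊖ 1𝔼)) ×
    NormPerfect ((λ𝔼 ^𝔼 (k ∸ 1)) ⊗ ((λ𝔼 ^𝔼 k) ⊖ 1𝔼))
theorem4p3 k _ k%12≡11 = subst EvenNormPerfectIfMersennePrime (sym k≡1+e)
  (MersenneFamily.evenNormPerfect e (s≤s z≤n) (T q) (1<T q) (λ𝔼^[10+12q] q) (π₃^[10+12q] q))
  where
  -- The hypothesis 1 < k follows from k % 12 ≡ 11.
  q = k / 12
  e = 10 ℕ.+ q ℕ.* 12
  k≡1+e : k ≡ suc e
  k≡1+e = trans (m≡m%n+[m/n]*n k 12) (cong (ℕ._+ q ℕ.* 12) k%12≡11)
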